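{- Let $F_3,\dots,F_{10}$ be formulas such that, for each $i=3,\dots,10$, $F_i$ does not preserve on $\mathfrak{B}_2$ the unary relation $R_i$, where $R_3=\{\mathbb{0},\sigma\}$, $R_4=\{\mathbb{0},\mathbb{1}\}$, $R_5=\{\rho,\sigma\}$, $R_6=\{\rho,\mathbb{1}\}$, $R_7=\{\mathbb{0},\rho,\sigma\}$, $R_8=\{\mathbb{0},\rho,\mathbb{1}\}$, $R_9=\{\mathbb{0},\sigma,\mathbb{1}\}$, $R_{10}=\{\rho,\sigma,\mathbb{1}\}$. Let $A(p)$, $B(p)$ be any formulas in one variable with $A[\mathbb{0}]\in\{\sigma,\mathbb{1}\}$ and $B[\mathbb{1}]\in\{\mathbb{0},\rho\}$, and let $C$ be a formula equivalent in $L\mathfrak{B}_2$ to the constant $0$ or to the constant $\rho$. Then all constants $0,\rho,\sigma,1$ are expressible in $L\mathfrak{B}_2$ via the formulas $F_3,\dots,F_{10},A,B,C$.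
   Context: Formulas of the propositional provability calculus are built from propositional variables using $\&,\vee,\supset,\neg$ and the unary modal connective $\Delta$. The constant formulas $p\&\neg p$, $p\supset p$, $\Delta(p\&\neg p)$, $\neg\Delta(p\&\neg p)$ are denoted $0,1,\sigma,\rho$. The algebra $\mathfrak{B}_2=(\{\mathbb{0},\rho,\sigma,\mathbb{1}\};\&,\vee,\supset,\neg,\Delta)$ is the four-element Boolean algebra with least element $\mathbb{0}$, greatest element $\mathbb{1}$ and atoms $\rho,\sigma$ (so $\neg\rho=\sigma$), with usual Boolean operations and $\Delta\mathbb{0}=\Delta\rho=\sigma$, $\Delta\sigma=\Delta\mathbb{1}=\mathbb{1}$; the constant formulas $0,\rho,\sigma,1$ take values $\mathbb{0},\rho,\sigma,\mathbb{1}$. $F[\alpha_1,\dots,\alpha_n]$ is the value of $F(p_1,\dots,p_n)$ on $\mathfrak{B}_2$ when $p_i$ takes value $\alpha_i$. $L\mathfrak{B}_2$ is the set of formulas taking value $\mathbb{1}$ under every evaluation on $\mathfrak{B}_2$; $A,B$ are equivalent in $L\mathfrak{B}_2$ if $(A\supset B)\&(B\supset A)\in L\mathfrak{B}_2$. A formula $F(p_1,\dots,p_n)$ preserves a unary relation $S\subseteq\mathfrak{B}_2$ if $\alpha_1,\dots,\alpha_n\in S$ implies $F[\alpha_1,\dots,\alpha_n]\in S$. A formula is expressible via a set of formulas $\Sigma$ in $L\mathfrak{B}_2$ if it belongs to the smallest set of formulas containing all propositional variables and all formulas of $\Sigma$ and closed under weak substitution (from $A$, $B$ obtain $A[p/B]$)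 and under replacement by formulas equivalent in $L\mathfrak{B}_2$. A constant $c$ is expressible if some formula equivalent in $L\mathfrak{B}_2$ to the constant formula $c$ is expressible. -}

module Defs where

open import Data.Nat using (ℕ; _<_; _≟_)
open import Data.Bool using (Bool; true; false)
open import Data.List using (List)
open import Data.List.Membership.Propositional using (_∈_)
open import Data.Product using (Σ; _×_)
open import Data.Sum using (_⊎_)
open import Relation.Nullary using (¬_; yes; no)
open import Relation.Binary.PropositionalEquality using (_≡_)

infixr 6 _&_
infixr 5 _∨_
infixr 4 _⊃_

data Fm : Set where
  var : ℕ → Fm
  _&_ _∨_ _⊃_ : Fm → Fm → Fm
  ¬f : Fm → Fm
  Δ : Fm → Fm

p : Fm
p = var 0

c0 c1 cσ cρ : Fm
c0 = p & ¬f p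
c1 = p ⊃ p
cσ = Δ (p & ¬f p)
cρ = ¬f (Δ (p & ¬f p))

-- The algebra 𝔅₂: four-element Boolean algebra with atoms ρ, σ

data B2 : Set where
  𝟘 ρ σ 𝟙 : B2

fstB sndB : B2 → Bool
fstB 𝟘 = false
fstB ρ = true
fstB σ = false
fstB 𝟙 = true
sndB 𝟘 = false
sndB ρ = false
sndB σ = true
sndB 𝟙 = true

mk : Bool → Bool → B2
mk false false = 𝟘
mk true  false = ρ
mk false true  = σ
mk true  true  = 𝟙

open import Data.Bool using (_∧_; not) renaming (_∨_ to _∨ᵇ_)

_&ᴮ_ _∨ᴮ_ _⊃ᴮ_ : B2 → B2 → B2
x &ᴮ y = mk (fstB x ∧ fstB y) (sndB x ∧ sndB y)
x ∨ᴮ y = mk (fstB x ∨ᵇ fstB y) (sndB x ∨ᵇ sndB y)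
x ⊃ᴮ y = mk (not (fstB x) ∨ᵇ fstB y) (not (sndB x) ∨ᵇ sndB y)

¬ᴮ : B2 → B2
¬ᴮ x = mk (not (fstB x)) (not (sndB x))

Δᴮ : B2 → B2
Δᴮ 𝟘 = σ
Δᴮ ρ = σ
Δᴮ σ = 𝟙
Δᴮ 𝟙 = 𝟙

eval : (ℕ → B2) → Fm → B2
eval v (var i) = v i
eval v (a & b) = eval v a &ᴮ eval v b
eval v (a ∨ b) = eval v a ∨ᴮ eval v b
eval v (a ⊃ b) = eval v a ⊃ᴮ eval v b
eval v (¬f a)  = ¬ᴮ (eval v a)
eval v (Δ a)   = Δᴮ (eval v a)

_[_] : Fm → B2 → B2
F [ α ] = eval (λ _ → α) F

LB2 : Fm → Set
LB2 F = ∀ (v : ℕ → B2) → eval v F ≡ 𝟙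

Equiv : Fm → Fm → Set
Equiv A B = LB2 ((A ⊃ B) & (B ⊃ A))

VarsBelow : ℕ → Fm → Set
VarsBelow n (var i) = i < n
VarsBelow n (a & b) = VarsBelow n a × VarsBelow n b
VarsBelow n (a ∨ b) = VarsBelow n a × VarsBelow n b
VarsBelow n (a ⊃ b) = VarsBelow n a × VarsBelow n b
VarsBelow n (¬f a)  = VarsBelow n a
VarsBelow n (Δ a)   = VarsBelow n a

OneVar : Fm → Set
OneVar = VarsBelow 1

Rel1 : Set
Rel1 = B2 → Bool

Preserves : Fm → Rel1 → Set
Preserves F S = ∀ (v : ℕ → B2) → (∀ i → S (v i) ≡ true) → S (eval v F) ≡ true

R3 R4 R5 R6 R7 R8 R9 R10 : Rel1
R3 𝟘 = true
R3 ρ = false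
R3 σ = true
R3 𝟙 = false
R4 𝟘 = true
R4 ρ = false
R4 σ = false
R4 𝟙 = true
R5 𝟘 = false
R5 ρ = true
R5 σ = true
R5 𝟙 = false
R6 𝟘 = false
R6 ρ = true
R6 σ = false
R6 𝟙 = true
R7 𝟘 = true
R7 ρ = true
R7 σ = true
R7 𝟙 = false
R8 𝟘 = true
R8 ρ = true
R8 σ = false
R8 𝟙 = true
R9 𝟘 = true
R9 ρ = false
R9 σ = true
R9 𝟙 = true
R10 𝟘 = false
R10 ρ = true
R10 σ = true
R10 𝟙 = true

subst : ℕ → Fm → Fm → Fm
subst i B (var j) with i ≟ j
... | yes _ = B
... | no  _ = var j
subst i B (a & b) = subst i B a & subst i B b
subst i B (a ∨ b) = subst i B a ∨ subst i B b
subst i B (a ⊃ b) = subst i B a ⊃ subst i B b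
subst i B (¬f a)  = ¬f (subst i B a)
subst i B (Δ a)   = Δ (subst i B a)

data Expressible (Σs : List Fm) : Fm → Set where
  ex-var   : ∀ i → Expressible Σs (var i)
  ex-base  : ∀ {F} → F ∈ Σs → Expressible Σs F
  ex-subst : ∀ {A B} i → Expressible Σs A → Expressible Σs B →
             Expressible Σs (subst i B A)
  ex-equiv : ∀ {A B} → Expressible Σs A → Equiv A B → Expressible Σs B

ExpressibleConst : List Fm → Fm → Set
ExpressibleConst Σs c = Σ Fm (λ D → Expressible Σs D × Equiv D c)

-- Call a value of 𝔅₂ expressible when some expressible formula denotes it under every
-- valuation. Expressible values are closed under every expressible formula F: substitute
-- formulas denoting them for the variables of F one at a time. If F does not preserve R,
-- a counterexample exists among the finitely many assignments to the variables of F, so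
-- once all values in R are expressible, F yields an expressible value outside R. Every
-- two-element set of values other than {0,ρ} and {σ,1} is one of R3–R6 and every
-- three-element set is one of R7–R10, so any such pair of expressible values grows to all
-- four. C supplies 0 or ρ, and A supplies a partner σ or 1 for it: for ρ because the
-- σ-coordinate of a value of A depends only on the σ-coordinates of the arguments, where
-- ρ and 0 agree.

module Submission where

open import Defs
open import Data.Bool using (true; false; _∧_; not) renaming (_∨_ to _∨ᵇ_)
import Data.Bool.Properties as Bool
open import Data.Empty using (⊥-elim)
open import Data.Fin using (toℕ; fromℕ<)
open import Data.Fin.Properties using (toℕ-fromℕ<)
open import Data.List using (List; []; _∷_)
open import Data.List.Relation.Unary.All using ([]; _∷_) renaming (tabulate to All-tabulate)
open import Data.Nat using (ℕ; zero; suc; _+_; _<_; _≤_; _⊔_; s≤s)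
open import Data.Nat.Properties using (m≤m⊔n; m≤n⊔m; <-≤-trans; ≤-refl; +-identityʳ; +-suc; m≢1+m+n)
import Data.Nat as ℕ
open import Data.Product using (Σ; ∃; _×_; _,_)
open import Data.Sum using (_⊎_; inj₁; inj₂; [_,_])
open import Data.Vec using (Vec; []; _∷_; lookup; tabulate)
open import Data.Vec.Properties using (lookup∘tabulate)
open import Data.Vec.Relation.Unary.All using (All; []; _∷_; all?)
import Data.Vec.Relation.Unary.All as All
open import Data.Vec.Relation.Unary.All.Properties using (tabulate⁺)
open import Function using (_∘_)
open import Relation.Nullary using (¬_; Dec; yes; no)
open import Relation.Nullary.Decidable using (map′; _×-dec_; _⊎-dec_)
open import Relation.Binary.PropositionalEquality using (_≡_; _≢_; refl; sym; trans; cong; cong₂; module ≡-Reasoning)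

⇔ᴮ-refl : ∀ x → (x ⊃ᴮ x) &ᴮ (x ⊃ᴮ x) ≡ 𝟙
⇔ᴮ-refl 𝟘 = refl
⇔ᴮ-refl ρ = refl
⇔ᴮ-refl σ = refl
⇔ᴮ-refl 𝟙 = refl

⇔ᴮ≡𝟙⇒≡ : ∀ x y → (x ⊃ᴮ y) &ᴮ (y ⊃ᴮ x) ≡ 𝟙 → x ≡ y
⇔ᴮ≡𝟙⇒≡ 𝟘 𝟘 _ = refl
⇔ᴮ≡𝟙⇒≡ ρ ρ _ = refl
⇔ᴮ≡𝟙⇒≡ σ σ _ = refl
⇔ᴮ≡𝟙⇒≡ 𝟙 𝟙 _ = refl
⇔ᴮ≡𝟙⇒≡ 𝟘 ρ () ; ⇔ᴮ≡𝟙⇒≡ 𝟘 σ () ; ⇔ᴮ≡𝟙⇒≡ 𝟘 𝟙 ()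
⇔ᴮ≡𝟙⇒≡ ρ 𝟘 () ; ⇔ᴮ≡𝟙⇒≡ ρ σ () ; ⇔ᴮ≡𝟙⇒≡ ρ 𝟙 ()
⇔ᴮ≡𝟙⇒≡ σ 𝟘 () ; ⇔ᴮ≡𝟙⇒≡ σ ρ () ; ⇔ᴮ≡𝟙⇒≡ σ 𝟙 ()
⇔ᴮ≡𝟙⇒≡ 𝟙 𝟘 () ; ⇔ᴮ≡𝟙⇒≡ 𝟙 ρ () ; ⇔ᴮ≡𝟙⇒≡ 𝟙 σ ()

Equiv-value : ∀ C c {x} → Equiv C c → (∀ v → eval v c ≡ x) → ∀ v → eval v C ≡ x
Equiv-value C c C⇔c c≡x v = trans (⇔ᴮ≡𝟙⇒≡ _ _ (C⇔c v)) (c≡x v)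

&ᴮ-¬ᴮ : ∀ x → x &ᴮ ¬ᴮ x ≡ 𝟘
&ᴮ-¬ᴮ 𝟘 = refl
&ᴮ-¬ᴮ ρ = refl
&ᴮ-¬ᴮ σ = refl
&ᴮ-¬ᴮ 𝟙 = refl

⊃ᴮ-refl : ∀ x → x ⊃ᴮ x ≡ 𝟙
⊃ᴮ-refl 𝟘 = refl
⊃ᴮ-refl ρ = refl
⊃ᴮ-refl σ = refl
⊃ᴮ-refl 𝟙 = refl

eval-c0 : ∀ v → eval v c0 ≡ 𝟘
eval-c0 v = &ᴮ-¬ᴮ (v 0)

eval-cσ : ∀ v → eval v cσ ≡ σ
eval-cσ v = cong Δᴮ (eval-c0 v)

eval-cρ : ∀ v → eval v cρ ≡ ρ
eval-cρ v = cong ¬ᴮ (eval-cσ v)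

eval-c1 : ∀ v → eval v c1 ≡ 𝟙
eval-c1 v = ⊃ᴮ-refl (v 0)

sndB-mk : ∀ a b → sndB (mk a b) ≡ b
sndB-mk false false = refl
sndB-mk false true  = refl
sndB-mk true  false = refl
sndB-mk true  true  = refl

sndB-mk-cong : ∀ {a b c d} → b ≡ d → sndB (mk a b) ≡ sndB (mk c d)
sndB-mk-cong {a} {b} {c} {d} b≡d = trans (sndB-mk a b) (trans b≡d (sym (sndB-mk c d)))

sndB-Δᴮ : ∀ x → sndB (Δᴮ x) ≡ true
sndB-Δᴮ 𝟘 = refl
sndB-Δᴮ ρ = refl
sndB-Δᴮ σ = refl
sndB-Δᴮ 𝟙 = refl

sndB-eval-cong : ∀ F {v w} → (∀ i → sndB (v i) ≡ sndB (w i)) → sndB (eval v F) ≡ sndB (eval w F)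
sndB-eval-cong (var i) v≈w = v≈w i
sndB-eval-cong (a & b) v≈w = sndB-mk-cong (cong₂ _∧_ (sndB-eval-cong a v≈w) (sndB-eval-cong b v≈w))
sndB-eval-cong (a ∨ b) v≈w = sndB-mk-cong (cong₂ _∨ᵇ_ (sndB-eval-cong a v≈w) (sndB-eval-cong b v≈w))
sndB-eval-cong (a ⊃ b) v≈w = sndB-mk-cong (cong₂ (λ x y → not x ∨ᵇ y) (sndB-eval-cong a v≈w) (sndB-eval-cong b v≈w))
sndB-eval-cong (¬f a)  v≈w = sndB-mk-cong (cong not (sndB-eval-cong a v≈w))
sndB-eval-cong (Δ a)   v≈w = trans (sndB-Δᴮ _) (sym (sndB-Δᴮ _))

sndB-[ρ]≡sndB-[𝟘] : ∀ F → sndB (F [ ρ ]) ≡ sndB (F [ 𝟘 ])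
sndB-[ρ]≡sndB-[𝟘] F = sndB-eval-cong F (λ _ → refl)

sndB≡true : ∀ {x} → sndB x ≡ true → x ≡ σ ⊎ x ≡ 𝟙
sndB≡true {𝟘} ()
sndB≡true {ρ} ()
sndB≡true {σ} _ = inj₁ refl
sndB≡true {𝟙} _ = inj₂ refl

Valuation : Set
Valuation = ℕ → B2

update : ℕ → B2 → Valuation → Valuation
update i a v j with i ℕ.≟ j
... | yes _ = a
... | no  _ = v j

update-same : ∀ i a v → update i a v i ≡ a
update-same i a v with i ℕ.≟ i
... | yes _ = refl
... | no i≢i = ⊥-elim (i≢i refl)

update-other : ∀ i a v {j} → i ≢ j → update i a v j ≡ v j
update-other i a v {j} i≢j with i ℕ.≟ j
... | yes i≡j = ⊥-elim (i≢j i≡j)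
... | no  _ = refl

eval-subst : ∀ i B A v → eval v (Defs.subst i B A) ≡ eval (update i (eval v B) v) A
eval-subst i B (var j) v with i ℕ.≟ j
... | yes _ = refl
... | no  _ = refl
eval-subst i B (a & b) v = cong₂ _&ᴮ_ (eval-subst i B a v) (eval-subst i B b v)
eval-subst i B (a ∨ b) v = cong₂ _∨ᴮ_ (eval-subst i B a v) (eval-subst i B b v)
eval-subst i B (a ⊃ b) v = cong₂ _⊃ᴮ_ (eval-subst i B a v) (eval-subst i B b v)
eval-subst i B (¬f a)  v = cong ¬ᴮ (eval-subst i B a v)
eval-subst i B (Δ a)   v = cong Δᴮ (eval-subst i B a v)

eval-cong-below : ∀ {n} F {v w : Valuation} → VarsBelow n F →
                  (∀ i → i < n → v i ≡ w i) → eval v F ≡ eval w F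
eval-cong-below (var i) i<n v≡w = v≡w i i<n
eval-cong-below (a & b) (ha , hb) v≡w = cong₂ _&ᴮ_ (eval-cong-below a ha v≡w) (eval-cong-below b hb v≡w)
eval-cong-below (a ∨ b) (ha , hb) v≡w = cong₂ _∨ᴮ_ (eval-cong-below a ha v≡w) (eval-cong-below b hb v≡w)
eval-cong-below (a ⊃ b) (ha , hb) v≡w = cong₂ _⊃ᴮ_ (eval-cong-below a ha v≡w) (eval-cong-below b hb v≡w)
eval-cong-below (¬f a)  ha        v≡w = cong ¬ᴮ (eval-cong-below a ha v≡w)
eval-cong-below (Δ a)   ha        v≡w = cong Δᴮ (eval-cong-below a ha v≡w)

varBound : Fm → ℕ
varBound (var i) = suc i
varBound (a & b) = varBound a ⊔ varBound b
varBound (a ∨ b) = varBound a ⊔ varBound b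
varBound (a ⊃ b) = varBound a ⊔ varBound b
varBound (¬f a)  = varBound a
varBound (Δ a)   = varBound a

VarsBelow-mono : ∀ {m n} F → m ≤ n → VarsBelow m F → VarsBelow n F
VarsBelow-mono (var i) m≤n i<m = <-≤-trans i<m m≤n
VarsBelow-mono (a & b) m≤n (ha , hb) = VarsBelow-mono a m≤n ha , VarsBelow-mono b m≤n hb
VarsBelow-mono (a ∨ b) m≤n (ha , hb) = VarsBelow-mono a m≤n ha , VarsBelow-mono b m≤n hb
VarsBelow-mono (a ⊃ b) m≤n (ha , hb) = VarsBelow-mono a m≤n ha , VarsBelow-mono b m≤n hb
VarsBelow-mono (¬f a)  m≤n ha        = VarsBelow-mono a m≤n ha
VarsBelow-mono (Δ a)   m≤n ha        = VarsBelow-mono a m≤n ha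

VarsBelow-⊔ : ∀ {m n} a b → VarsBelow m a → VarsBelow n b →
              VarsBelow (m ⊔ n) a × VarsBelow (m ⊔ n) b
VarsBelow-⊔ {m} {n} a b ha hb = VarsBelow-mono a (m≤m⊔n m n) ha , VarsBelow-mono b (m≤n⊔m m n) hb

VarsBelow-varBound : ∀ F → VarsBelow (varBound F) F
VarsBelow-varBound (var i) = ≤-refl
VarsBelow-varBound (a & b) = VarsBelow-⊔ a b (VarsBelow-varBound a) (VarsBelow-varBound b)
VarsBelow-varBound (a ∨ b) = VarsBelow-⊔ a b (VarsBelow-varBound a) (VarsBelow-varBound b)
VarsBelow-varBound (a ⊃ b) = VarsBelow-⊔ a b (VarsBelow-varBound a) (VarsBelow-varBound b)
VarsBelow-varBound (¬f a)  = VarsBelow-varBound a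
VarsBelow-varBound (Δ a)   = VarsBelow-varBound a

override : ∀ {n} → ℕ → Vec B2 n → Valuation → Valuation
override k []       v = v
override k (a ∷ as) v = update k a (override (suc k) as v)

override-lookup : ∀ {n} k (as : Vec B2 n) v {i} (i<n : i < n) →
                  override k as v (k + i) ≡ lookup as (fromℕ< i<n)
override-lookup k (a ∷ as) v {zero} _ rewrite +-identityʳ k = update-same k a _
override-lookup k (a ∷ as) v {suc i} (s≤s i<n) rewrite +-suc k i =
  trans (update-other k a _ (m≢1+m+n k)) (override-lookup (suc k) as v i<n)

⟦_⟧ : ∀ {n} → Vec B2 n → Valuation
⟦ as ⟧ = override 0 as (λ _ → 𝟘)

eval-tabulate : ∀ n F v → VarsBelow n F → eval ⟦ tabulate {n = n} (v ∘ toℕ) ⟧ F ≡ eval v F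
eval-tabulate n F v hF = eval-cong-below F hF λ i i<n → begin
  ⟦ as ⟧ i                   ≡⟨ override-lookup 0 as _ i<n ⟩
  lookup as (fromℕ< i<n)     ≡⟨ lookup∘tabulate (v ∘ toℕ) (fromℕ< i<n) ⟩
  v (toℕ (fromℕ< i<n))       ≡⟨ cong v (toℕ-fromℕ< i<n) ⟩
  v i                        ∎
  where
  open ≡-Reasoning
  as : Vec B2 n
  as = tabulate (v ∘ toℕ)

∃-B2? : {P : B2 → Set} → (∀ x → Dec (P x)) → Dec (∃ P)
∃-B2? {P} P? = map′ to from (P? 𝟘 ⊎-dec P? ρ ⊎-dec P? σ ⊎-dec P? 𝟙)
  where
  to : P 𝟘 ⊎ P ρ ⊎ P σ ⊎ P 𝟙 → ∃ P
  to (inj₁ p)               = 𝟘 , p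
  to (inj₂ (inj₁ p))        = ρ , p
  to (inj₂ (inj₂ (inj₁ p))) = σ , p
  to (inj₂ (inj₂ (inj₂ p))) = 𝟙 , p
  from : ∃ P → P 𝟘 ⊎ P ρ ⊎ P σ ⊎ P 𝟙
  from (𝟘 , p) = inj₁ p
  from (ρ , p) = inj₂ (inj₁ p)
  from (σ , p) = inj₂ (inj₂ (inj₁ p))
  from (𝟙 , p) = inj₂ (inj₂ (inj₂ p))

∃-Vec? : ∀ n {P : Vec B2 n → Set} → (∀ as → Dec (P as)) → Dec (∃ P)
∃-Vec? zero    P? = map′ ([] ,_) (λ { ([] , p) → p }) (P? [])
∃-Vec? (suc n) P? =
  map′ (λ { (a , as , p) → a ∷ as , p }) (λ { (a ∷ as , p) → a , as , p })
       (∃-B2? λ a → ∃-Vec? n λ as → P? (a ∷ as))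

counterexample : ∀ F R → ¬ Preserves F R →
  ∃ λ (as : Vec B2 (varBound F)) → All (λ x → R x ≡ true) as × R (eval ⟦ as ⟧ F) ≡ false
counterexample F R ¬pres with ∃-Vec? (varBound F) (λ as →
  all? (λ x → R x Bool.≟ true) as ×-dec (R (eval ⟦ as ⟧ F) Bool.≟ false))
... | yes found = found
... | no ¬found = ⊥-elim (¬pres preserves)
  where
  preserves : Preserves F R
  preserves v Rv with R (eval v F) in Rv-F
  ... | true  = refl
  ... | false = ⊥-elim (¬found (tabulate (v ∘ toℕ) , tabulate⁺ (Rv ∘ toℕ) ,
                  trans (cong R (eval-tabulate (varBound F) F v (VarsBelow-varBound F))) Rv-F))

module _ (Σs : List Fm) where

  ExpressibleValue : B2 → Set
  ExpressibleValue x = Σ Fm λ D → Expressible Σs D × (∀ v → eval v D ≡ x)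

  -- K may mention the variables p_(k+1), … that later steps replace; this is harmless
  -- because K denotes the same value under every valuation.
  substitute-values : ∀ {n} k (as : Vec B2 n) → All ExpressibleValue as →
                      ∀ {F} → Expressible Σs F →
                      Σ Fm λ D → Expressible Σs D × (∀ v → eval v D ≡ eval (override k as v) F)
  substitute-values k []       []                      {F} ex-F = F , ex-F , λ _ → refl
  substitute-values k (a ∷ as) ((K , ex-K , K≡a) ∷ has) {F} ex-F
    with substitute-values (suc k) as has (ex-subst k ex-F ex-K)
  ... | D , ex-D , D≡ = D , ex-D , λ v → trans (D≡ v) (eval-subst-value (override (suc k) as v))
    where
    eval-subst-value : ∀ w → eval w (Defs.subst k K F) ≡ eval (update k a w) F
    eval-subst-value w = trans (eval-subst k K F w) (cong (λ x → eval (update k x w) F) (K≡a w))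

  eval-expressible : ∀ {n F} → Expressible Σs F → VarsBelow n F →
                     (as : Vec B2 n) → All ExpressibleValue as → ExpressibleValue (eval ⟦ as ⟧ F)
  eval-expressible {F = F} ex-F hF as has with substitute-values 0 as has ex-F
  ... | D , ex-D , D≡ = D , ex-D , λ v → trans (D≡ v) (eval-cong-below F hF λ i i<n →
          trans (override-lookup 0 as v i<n) (sym (override-lookup 0 as _ i<n)))

  apply-oneVar : ∀ {A} → Expressible Σs A → OneVar A →
                 ∀ {x y} → A [ x ] ≡ y → ExpressibleValue x → ExpressibleValue y
  apply-oneVar {A} ex-A hA {x} A[x]≡y hx with eval-expressible ex-A hA (x ∷ []) (hx ∷ [])
  ... | D , ex-D , D≡ = D , ex-D , λ v → trans (D≡ v) (trans (eval-cong-below A hA agree) A[x]≡y)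
    where
    agree : ∀ i → i < 1 → ⟦ x ∷ [] ⟧ i ≡ x
    agree zero    _ = refl
    agree (suc _) (s≤s ())

  AllValuesExpressible : Set
  AllValuesExpressible = ExpressibleValue 𝟘 × ExpressibleValue ρ × ExpressibleValue σ × ExpressibleValue 𝟙

  expressibleConst : ∀ c {x} → (∀ v → eval v c ≡ x) → ExpressibleValue x → ExpressibleConst Σs c
  expressibleConst c {x} c≡x (D , ex-D , D≡x) = D , ex-D , λ v → ⇔ᴮ-resp (D≡x v) (c≡x v)
    where
    ⇔ᴮ-resp : ∀ {a b} → a ≡ x → b ≡ x → (a ⊃ᴮ b) &ᴮ (b ⊃ᴮ a) ≡ 𝟙
    ⇔ᴮ-resp refl refl = ⇔ᴮ-refl x

  expressibleConsts : AllValuesExpressible →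
    ExpressibleConst Σs c0 × ExpressibleConst Σs cρ × ExpressibleConst Σs cσ × ExpressibleConst Σs c1
  expressibleConsts (h𝟘 , hρ , hσ , h𝟙) =
    expressibleConst c0 eval-c0 h𝟘 , expressibleConst cρ eval-cρ hρ ,
    expressibleConst cσ eval-cσ hσ , expressibleConst c1 eval-c1 h𝟙

  Escapes : Rel1 → Set
  Escapes R = (∀ x → R x ≡ true → ExpressibleValue x) → ∃ λ y → R y ≡ false × ExpressibleValue y

  escapes : ∀ {F} R → Expressible Σs F → ¬ Preserves F R → Escapes R
  escapes {F} R ex-F ¬pres R⊆E with counterexample F R ¬pres
  ... | as , R-as , R-out =
    _ , R-out , eval-expressible ex-F (VarsBelow-varBound F) as (All.map (R⊆E _) R-as)

module Saturation (Σs : List Fm)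
  (escapes₃ : Escapes Σs R3) (escapes₄ : Escapes Σs R4) (escapes₅ : Escapes Σs R5)
  (escapes₆ : Escapes Σs R6) (escapes₇ : Escapes Σs R7) (escapes₈ : Escapes Σs R8)
  (escapes₉ : Escapes Σs R9) (escapes₁₀ : Escapes Σs R10) where

  private
    E : B2 → Set
    E = ExpressibleValue Σs

  from-𝟘ρσ : E 𝟘 → E ρ → E σ → AllValuesExpressible Σs
  from-𝟘ρσ h𝟘 hρ hσ with escapes₇ (λ { 𝟘 _ → h𝟘 ; ρ _ → hρ ; σ _ → hσ ; 𝟙 () })
  ... | 𝟙 , _ , h𝟙 = h𝟘 , hρ , hσ , h𝟙
  ... | 𝟘 , () , _
  ... | ρ , () , _
  ... | σ , () , _

  from-𝟘ρ𝟙 : E 𝟘 → E ρ → E 𝟙 → AllValuesExpressible Σs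
  from-𝟘ρ𝟙 h𝟘 hρ h𝟙 with escapes₈ (λ { 𝟘 _ → h𝟘 ; ρ _ → hρ ; 𝟙 _ → h𝟙 ; σ () })
  ... | σ , _ , hσ = h𝟘 , hρ , hσ , h𝟙
  ... | 𝟘 , () , _
  ... | ρ , () , _
  ... | 𝟙 , () , _

  from-𝟘σ𝟙 : E 𝟘 → E σ → E 𝟙 → AllValuesExpressible Σs
  from-𝟘σ𝟙 h𝟘 hσ h𝟙 with escapes₉ (λ { 𝟘 _ → h𝟘 ; σ _ → hσ ; 𝟙 _ → h𝟙 ; ρ () })
  ... | ρ , _ , hρ = h𝟘 , hρ , hσ , h𝟙
  ... | 𝟘 , () , _
  ... | σ , () , _
  ... | 𝟙 , () , _

  from-ρσ𝟙 : E ρ → E σ → E 𝟙 → AllValuesExpressible Σs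
  from-ρσ𝟙 hρ hσ h𝟙 with escapes₁₀ (λ { ρ _ → hρ ; σ _ → hσ ; 𝟙 _ → h𝟙 ; 𝟘 () })
  ... | 𝟘 , _ , h𝟘 = h𝟘 , hρ , hσ , h𝟙
  ... | ρ , () , _
  ... | σ , () , _
  ... | 𝟙 , () , _

  from-𝟘σ : E 𝟘 → E σ → AllValuesExpressible Σs
  from-𝟘σ h𝟘 hσ with escapes₃ (λ { 𝟘 _ → h𝟘 ; σ _ → hσ ; ρ () ; 𝟙 () })
  ... | ρ , _ , hρ = from-𝟘ρσ h𝟘 hρ hσ
  ... | 𝟙 , _ , h𝟙 = from-𝟘σ𝟙 h𝟘 hσ h𝟙
  ... | 𝟘 , () , _
  ... | σ , () , _

  from-𝟘𝟙 : E 𝟘 → E 𝟙 → AllValuesExpressible Σs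
  from-𝟘𝟙 h𝟘 h𝟙 with escapes₄ (λ { 𝟘 _ → h𝟘 ; 𝟙 _ → h𝟙 ; ρ () ; σ () })
  ... | ρ , _ , hρ = from-𝟘ρ𝟙 h𝟘 hρ h𝟙
  ... | σ , _ , hσ = from-𝟘σ𝟙 h𝟘 hσ h𝟙
  ... | 𝟘 , () , _
  ... | 𝟙 , () , _

  from-ρσ : E ρ → E σ → AllValuesExpressible Σs
  from-ρσ hρ hσ with escapes₅ (λ { ρ _ → hρ ; σ _ → hσ ; 𝟘 () ; 𝟙 () })
  ... | 𝟘 , _ , h𝟘 = from-𝟘ρσ h𝟘 hρ hσ
  ... | 𝟙 , _ , h𝟙 = from-ρσ𝟙 hρ hσ h𝟙
  ... | ρ , () , _
  ... | σ , () , _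

  from-ρ𝟙 : E ρ → E 𝟙 → AllValuesExpressible Σs
  from-ρ𝟙 hρ h𝟙 with escapes₆ (λ { ρ _ → hρ ; 𝟙 _ → h𝟙 ; 𝟘 () ; σ () })
  ... | 𝟘 , _ , h𝟘 = from-𝟘ρ𝟙 h𝟘 hρ h𝟙
  ... | σ , _ , hσ = from-ρσ𝟙 hρ hσ h𝟙
  ... | ρ , () , _
  ... | 𝟙 , () , _

  module _ {A} (ex-A : Expressible Σs A) (A-oneVar : OneVar A) where

    from-𝟘 : A [ 𝟘 ] ≡ σ ⊎ A [ 𝟘 ] ≡ 𝟙 → E 𝟘 → AllValuesExpressible Σs
    from-𝟘 (inj₁ A[𝟘]≡σ) h𝟘 = from-𝟘σ h𝟘 (apply-oneVar Σs ex-A A-oneVar A[𝟘]≡σ h𝟘)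
    from-𝟘 (inj₂ A[𝟘]≡𝟙) h𝟘 = from-𝟘𝟙 h𝟘 (apply-oneVar Σs ex-A A-oneVar A[𝟘]≡𝟙 h𝟘)

    from-ρ : A [ 𝟘 ] ≡ σ ⊎ A [ 𝟘 ] ≡ 𝟙 → E ρ → AllValuesExpressible Σs
    from-ρ A[𝟘] hρ with sndB≡true (trans (sndB-[ρ]≡sndB-[𝟘] A) ([ cong sndB , cong sndB ] A[𝟘]))
    ... | inj₁ A[ρ]≡σ = from-ρσ hρ (apply-oneVar Σs ex-A A-oneVar A[ρ]≡σ hρ)
    ... | inj₂ A[ρ]≡𝟙 = from-ρ𝟙 hρ (apply-oneVar Σs ex-A A-oneVar A[ρ]≡𝟙 hρ)

lemma5 : (F3 F4 F5 F6 F7 F8 F9 F10 A B C : Fm) →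
    ¬ Preserves F3 R3 → ¬ Preserves F4 R4 → ¬ Preserves F5 R5 →
    ¬ Preserves F6 R6 → ¬ Preserves F7 R7 → ¬ Preserves F8 R8 →
    ¬ Preserves F9 R9 → ¬ Preserves F10 R10 →
    OneVar A → OneVar B →
    (A [ 𝟘 ] ≡ σ ⊎ A [ 𝟘 ] ≡ 𝟙) →
    (B [ 𝟙 ] ≡ 𝟘 ⊎ B [ 𝟙 ] ≡ ρ) →
    (Equiv C c0 ⊎ Equiv C cρ) →
    let Σs = F3 ∷ F4 ∷ F5 ∷ F6 ∷ F7 ∷ F8 ∷ F9 ∷ F10 ∷ A ∷ B ∷ C ∷ [] in
    ExpressibleConst Σs c0 × ExpressibleConst Σs cρ ×
    ExpressibleConst Σs cσ × ExpressibleConst Σs c1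
lemma5 F3 F4 F5 F6 F7 F8 F9 F10 A B C ¬p3 ¬p4 ¬p5 ¬p6 ¬p7 ¬p8 ¬p9 ¬p10 A-oneVar _ A[𝟘] _ C-const
  with All-tabulate {P = Expressible (F3 ∷ F4 ∷ F5 ∷ F6 ∷ F7 ∷ F8 ∷ F9 ∷ F10 ∷ A ∷ B ∷ C ∷ [])} ex-base
... | e3 ∷ e4 ∷ e5 ∷ e6 ∷ e7 ∷ e8 ∷ e9 ∷ e10 ∷ eA ∷ _ ∷ eC ∷ [] = expressibleConsts Σs (from-C C-const)
  where
  Σs = F3 ∷ F4 ∷ F5 ∷ F6 ∷ F7 ∷ F8 ∷ F9 ∷ F10 ∷ A ∷ B ∷ C ∷ []
  open Saturation Σs (escapes Σs R3 e3 ¬p3) (escapes Σs R4 e4 ¬p4) (escapes Σs R5 e5 ¬p5)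
    (escapes Σs R6 e6 ¬p6) (escapes Σs R7 e7 ¬p7) (escapes Σs R8 e8 ¬p8)
    (escapes Σs R9 e9 ¬p9) (escapes Σs R10 e10 ¬p10)

  from-C : Equiv C c0 ⊎ Equiv C cρ → AllValuesExpressible Σs
  from-C (inj₁ C⇔0) = from-𝟘 eA A-oneVar A[𝟘] (C , eC , Equiv-value C c0 C⇔0 eval-c0)
  from-C (inj₂ C⇔ρ) = from-ρ eA A-oneVar A[𝟘] (C , eC , Equiv-value C cρ C⇔ρ eval-cρ)
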